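{- Let $t>2$ be a natural number, $n=2t+1$, and let $W=2^t+2+1$ be the Welch exponent. Then $W$ and $e(3,i)$ never lie in the same cyclotomic coset modulo $2^n-1$ for any $0<i<n$; i.e., there is no natural number $a$ with $2^a e(3,i)\equiv W\pmod{2^n-1}$.
   Context: For natural numbers $l,k$, $e(l,k)=\sum_{j=0}^{l-1}2^{jk}$. The cyclotomic coset of $d$ modulo $2^n-1$ is $\{2^a d \bmod (2^n-1): a\ge 0\}$. -}

module Defs where

open import Data.Nat using (ℕ; zero; suc; _+_; _*_; _^_; ∣_-_∣)
open import Data.Nat.Divisibility using (_∣_)

e : ℕ → ℕ → ℕ
e zero    k = 0
e (suc l) k = e l k + 2 ^ (l * k)

welch : ℕ → ℕ
welch t = 2 ^ t + 2 + 1

_≡_[mod_] : ℕ → ℕ → ℕ → Set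
x ≡ y [mod m ] = m ∣ ∣ x - y ∣

-- Modulo M = 2^n − 1 only the residue of an exponent of 2 modulo n matters, so 2^a e(3,i) ≡ 2^p + 2^q + 2^r
-- where p, q, r are the residues of a, a + i, a + 2i.  Because n = 2t + 1 is odd and 0 < i < n these
-- residues are distinct, so 2^p + 2^q + 2^r ≤ M and its congruence with W = 2^t + 2 + 1 < M is an equality.
-- Uniqueness of binary expansions then forces {p, q, r} = {0, 1, t}.  But p + r ≡ 2q (mod n), which for the
-- possible middle exponents q = 0, 1, t reads t + 1 ≡ 0, t ≡ 2 or 1 ≡ 2t, and none of these holds for t > 2.
module Submission where

open import Data.Empty using (⊥-elim)
open import Data.Nat using (ℕ; zero; suc; _+_; _*_; _∸_; _^_; _<_; _≤_; _%_; _/_; ∣_-_∣; NonZero; >-nonZero; z≤n; s≤s)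
open import Data.Nat.Coprimality using (Coprime; 1-coprimeTo; coprime-+; coprime-divisor)
open import Data.Nat.DivMod
open import Data.Nat.Divisibility using (_∣_; divides; ∣m+n∣m⇒∣n; n∣m*n; >⇒∤)
open import Data.Nat.Logarithm using (⌊log₂_⌋; ⌊log₂[2^n]⌋≡n)
open import Data.Nat.Properties
open import Algebra.Properties.CommutativeSemigroup +-commutativeSemigroup
  using (xy∙z≈xz∙y; xy∙z≈zx∙y; xy∙z≈yx∙z; xy∙z≈yz∙x)
open import Data.Nat.Tactic.RingSolver using (solve-∀)
open import Data.Product using (∃; _×_; _,_)
open import Data.Sum using (_⊎_; inj₁; inj₂)
open import Function using (_∘_)
open import Relation.Binary using (Tri; tri<; tri≈; tri>)
open import Relation.Binary.PropositionalEquality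
open import Relation.Nullary using (¬_)

open import Defs

Distinct : ℕ → ℕ → ℕ → Set
Distinct p q r = p ≢ q × q ≢ r × p ≢ r

d∣n∸m⇒n%d≡m%d : ∀ {m n} d .{{_ : NonZero d}} → m ≤ n → d ∣ n ∸ m → n % d ≡ m % d
d∣n∸m⇒n%d≡m%d {m} d m≤n d∣n∸m = trans (cong (_% d) (sym (m+[n∸m]≡n m≤n))) (%-remove-+ʳ m d∣n∸m)

d∣∣m-n∣⇒m%d≡n%d : ∀ {m n} d .{{_ : NonZero d}} → d ∣ ∣ m - n ∣ → m % d ≡ n % d
d∣∣m-n∣⇒m%d≡n%d {m} {n} d d∣ with ≤-total m n
... | inj₁ m≤n = sym (d∣n∸m⇒n%d≡m%d d m≤n (subst (d ∣_) (m≤n⇒∣m-n∣≡n∸m m≤n) d∣))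
... | inj₂ n≤m = d∣n∸m⇒n%d≡m%d d n≤m (subst (d ∣_) (trans (∣-∣-comm m n) (m≤n⇒∣m-n∣≡n∸m n≤m)) d∣)

[m+n]%d≡m%d⇒d∣n : ∀ m n d .{{_ : NonZero d}} → (m + n) % d ≡ m % d → d ∣ n
[m+n]%d≡m%d⇒d∣n m n d eq = ∣m+n∣m⇒∣n (divides ((m + n) / d) quotients) (n∣m*n (m / d))
  where
  open ≡-Reasoning
  quotients : m / d * d + n ≡ (m + n) / d * d
  quotients = +-cancelˡ-≡ (m % d) _ _ (begin
    m % d + (m / d * d + n)        ≡⟨ sym (+-assoc (m % d) _ n) ⟩
    m % d + m / d * d + n          ≡⟨ cong (_+ n) (sym (m≡m%n+[m/n]*n m d)) ⟩
    m + n                          ≡⟨ m≡m%n+[m/n]*n (m + n) d ⟩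
    (m + n) % d + (m + n) / d * d  ≡⟨ cong (_+ (m + n) / d * d) eq ⟩
    m % d + (m + n) / d * d        ∎)

%-cong-+ : ∀ {a b c e} d .{{_ : NonZero d}} → a % d ≡ c % d → b % d ≡ e % d → (a + b) % d ≡ (c + e) % d
%-cong-+ {a} {b} {c} {e} d a≡c b≡e =
  trans (%-distribˡ-+ a b d) (trans (cong₂ (λ x y → (x + y) % d) a≡c b≡e) (sym (%-distribˡ-+ c e d)))

%-injective-< : ∀ {m n d} .{{_ : NonZero d}} → m < d → n < d → m % d ≡ n % d → m ≡ n
%-injective-< m<d n<d eq = trans (sym (m<n⇒m%n≡m m<d)) (trans eq (m<n⇒m%n≡m n<d))

m≤d⇒m%d≡n⇒m≡n : ∀ {m n d} .{{_ : NonZero d}} → m ≤ d → n ≢ 0 → m % d ≡ n → m ≡ n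
m≤d⇒m%d≡n⇒m≡n {d = d} m≤d n≢0 eq with m≤n⇒m<n∨m≡n m≤d
... | inj₁ m<d  = trans (sym (m<n⇒m%n≡m m<d)) eq
... | inj₂ refl = ⊥-elim (n≢0 (trans (sym eq) (n%n≡0 d)))

module _ {n : ℕ} .{{_ : NonZero n}} where

  distinct-residues : ∀ a d → ¬ n ∣ d → ¬ n ∣ 2 * d → Distinct (a % n) ((a + d) % n) ((a + 2 * d) % n)
  distinct-residues a d n∤d n∤2d =
      (λ eq → n∤d ([m+n]%d≡m%d⇒d∣n a d n (sym eq)))
    , (λ eq → n∤d ([m+n]%d≡m%d⇒d∣n (a + d) d n (trans (cong (_% n) (a+d+d≡a+2d a d)) (sym eq))))
    , (λ eq → n∤2d ([m+n]%d≡m%d⇒d∣n a (2 * d) n (sym eq)))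
    where
    a+d+d≡a+2d : ∀ a d → a + d + d ≡ a + 2 * d
    a+d+d≡a+2d = solve-∀

  residues-in-progression : ∀ a d → (a % n + (a + 2 * d) % n) % n ≡ ((a + d) % n + (a + d) % n) % n
  residues-in-progression a d = begin
    (a % n + (a + 2 * d) % n) % n    ≡⟨ sym (%-distribˡ-+ a (a + 2 * d) n) ⟩
    (a + (a + 2 * d)) % n            ≡⟨ cong (_% n) (a+[a+2d]≡[a+d]+[a+d] a d) ⟩
    ((a + d) + (a + d)) % n          ≡⟨ %-distribˡ-+ (a + d) (a + d) n ⟩
    ((a + d) % n + (a + d) % n) % n  ∎
    where
    open ≡-Reasoning
    a+[a+2d]≡[a+d]+[a+d] : ∀ a d → a + (a + 2 * d) ≡ (a + d) + (a + d)
    a+[a+2d]≡[a+d]+[a+d] = solve-∀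

2t+1-coprime-2 : ∀ t → Coprime (2 * t + 1) 2
2t+1-coprime-2 zero    = 1-coprimeTo 2
2t+1-coprime-2 (suc t) = subst (λ m → Coprime m 2) (2+[2t+1]≡2[1+t]+1 t) (coprime-+ (2t+1-coprime-2 t))
  where
  2+[2t+1]≡2[1+t]+1 : ∀ t → 2 + (2 * t + 1) ≡ 2 * suc t + 1
  2+[2t+1]≡2[1+t]+1 = solve-∀

m<2^n⇒m+2^n<2^[1+n] : ∀ {m} n → m < 2 ^ n → m + 2 ^ n < 2 ^ suc n
m<2^n⇒m+2^n<2^[1+n] {m} n m<2^n =
  subst (m + 2 ^ n <_) (cong (2 ^ n +_) (sym (+-identityʳ (2 ^ n)))) (+-monoˡ-< (2 ^ n) m<2^n)

x<y⇒2^x+2^y<2^[1+y] : ∀ {x y} → x < y → 2 ^ x + 2 ^ y < 2 ^ suc y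
x<y⇒2^x+2^y<2^[1+y] {y = y} x<y = m<2^n⇒m+2^n<2^[1+n] y (^-monoʳ-< 2 (n<1+n 1) x<y)

2^x+2^y<2^z : ∀ {x y z} → x ≢ y → x < z → y < z → 2 ^ x + 2 ^ y < 2 ^ z
2^x+2^y<2^z {x} {y} {z} x≢y x<z y<z with <-cmp x y
... | tri< x<y _ _ = <-≤-trans (x<y⇒2^x+2^y<2^[1+y] x<y) (^-monoʳ-≤ 2 y<z)
... | tri≈ _ x≡y _ = ⊥-elim (x≢y x≡y)
... | tri> _ _ y<x = subst (_< 2 ^ z) (+-comm (2 ^ y) (2 ^ x)) (<-≤-trans (x<y⇒2^x+2^y<2^[1+y] y<x) (^-monoʳ-≤ 2 x<z))

2^x+2^y+2^z<2^n : ∀ {x y z n} → x ≢ y → x < z → y < z → z < n → 2 ^ x + 2 ^ y + 2 ^ z < 2 ^ n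
2^x+2^y+2^z<2^n {z = z} x≢y x<z y<z z<n =
  <-≤-trans (m<2^n⇒m+2^n<2^[1+n] z (2^x+2^y<2^z x≢y x<z y<z)) (^-monoʳ-≤ 2 z<n)

distinct⇒2^p+2^q+2^r<2^n : ∀ {p q r n} → Distinct p q r → p < n → q < n → r < n → 2 ^ p + 2 ^ q + 2 ^ r < 2 ^ n
distinct⇒2^p+2^q+2^r<2^n {p} {q} {r} {n} (p≢q , q≢r , p≢r) p<n q<n r<n = by-maximum (<-cmp p r) (<-cmp q r)
  where
  p-max : q < p → r < p → 2 ^ p + 2 ^ q + 2 ^ r < 2 ^ n
  p-max q<p r<p = subst (_< 2 ^ n) (xy∙z≈zx∙y (2 ^ q) (2 ^ r) (2 ^ p)) (2^x+2^y+2^z<2^n q≢r q<p r<p p<n)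
  q-max : p < q → r < q → 2 ^ p + 2 ^ q + 2 ^ r < 2 ^ n
  q-max p<q r<q = subst (_< 2 ^ n) (xy∙z≈xz∙y (2 ^ p) (2 ^ r) (2 ^ q)) (2^x+2^y+2^z<2^n p≢r p<q r<q q<n)

  by-maximum : Tri (p < r) (p ≡ r) (r < p) → Tri (q < r) (q ≡ r) (r < q) → 2 ^ p + 2 ^ q + 2 ^ r < 2 ^ n
  by-maximum (tri≈ _ p≡r _) _              = ⊥-elim (p≢r p≡r)
  by-maximum _              (tri≈ _ q≡r _) = ⊥-elim (q≢r q≡r)
  by-maximum (tri< p<r _ _) (tri< q<r _ _) = 2^x+2^y+2^z<2^n p≢q p<r q<r r<n
  by-maximum (tri< p<r _ _) (tri> _ _ r<q) = q-max (<-trans p<r r<q) r<q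
  by-maximum (tri> _ _ r<p) (tri< q<r _ _) = p-max (<-trans q<r r<p) r<p
  by-maximum (tri> _ _ r<p) (tri> _ _ r<q) with <-cmp p q
  ... | tri< p<q _ _ = q-max p<q r<q
  ... | tri≈ _ p≡q _ = ⊥-elim (p≢q p≡q)
  ... | tri> _ _ q<p = p-max q<p r<p

2^a*e[3,i] : ∀ a i → 2 ^ a * e 3 i ≡ 2 ^ a + 2 ^ (a + i) + 2 ^ (a + 2 * i)
2^a*e[3,i] a i = begin
  2 ^ a * (1 + 2 ^ (i + 0) + 2 ^ (2 * i))      ≡⟨ cong (λ m → 2 ^ a * (1 + 2 ^ m + 2 ^ (2 * i))) (+-identityʳ i) ⟩
  2 ^ a * (1 + 2 ^ i + 2 ^ (2 * i))            ≡⟨ distrib (2 ^ a) (2 ^ i) (2 ^ (2 * i)) ⟩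
  2 ^ a + 2 ^ a * 2 ^ i + 2 ^ a * 2 ^ (2 * i)  ≡⟨ cong₂ (λ x y → 2 ^ a + x + y) (sym (^-distribˡ-+-* 2 a i))
                                                                              (sym (^-distribˡ-+-* 2 a (2 * i))) ⟩
  2 ^ a + 2 ^ (a + i) + 2 ^ (a + 2 * i)        ∎
  where
  open ≡-Reasoning
  distrib : ∀ x y z → x * (1 + y + z) ≡ x + x * y + x * z
  distrib = solve-∀

module _ {n M : ℕ} .{{_ : NonZero n}} .{{_ : NonZero M}} (2^n≡1+M : 2 ^ n ≡ 1 + M) where
  open ≡-Reasoning

  2^[jn+k]%M≡2^k%M : ∀ j k → 2 ^ (j * n + k) % M ≡ 2 ^ k % M
  2^[jn+k]%M≡2^k%M zero    k = refl
  2^[jn+k]%M≡2^k%M (suc j) k = begin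
    2 ^ (n + j * n + k) % M                   ≡⟨ cong (λ m → 2 ^ m % M) (+-assoc n (j * n) k) ⟩
    2 ^ (n + (j * n + k)) % M                 ≡⟨ cong (_% M) (^-distribˡ-+-* 2 n (j * n + k)) ⟩
    2 ^ n * 2 ^ (j * n + k) % M               ≡⟨ cong (λ m → m * 2 ^ (j * n + k) % M) 2^n≡1+M ⟩
    (2 ^ (j * n + k) + M * 2 ^ (j * n + k)) % M ≡⟨ cong (λ m → (2 ^ (j * n + k) + m) % M) (*-comm M _) ⟩
    (2 ^ (j * n + k) + 2 ^ (j * n + k) * M) % M ≡⟨ [m+kn]%n≡m%n (2 ^ (j * n + k)) (2 ^ (j * n + k)) M ⟩
    2 ^ (j * n + k) % M                       ≡⟨ 2^[jn+k]%M≡2^k%M j k ⟩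
    2 ^ k % M                                 ∎

  2^k%M≡2^[k%n]%M : ∀ k → 2 ^ k % M ≡ 2 ^ (k % n) % M
  2^k%M≡2^[k%n]%M k = begin
    2 ^ k % M                    ≡⟨ cong (λ m → 2 ^ m % M) (m≡m%n+[m/n]*n k n) ⟩
    2 ^ (k % n + k / n * n) % M  ≡⟨ cong (λ m → 2 ^ m % M) (+-comm (k % n) _) ⟩
    2 ^ (k / n * n + k % n) % M  ≡⟨ 2^[jn+k]%M≡2^k%M (k / n) (k % n) ⟩
    2 ^ (k % n) % M              ∎

  2^a*e[3,i]%M : ∀ a i → 2 ^ a * e 3 i % M ≡ (2 ^ (a % n) + 2 ^ ((a + i) % n) + 2 ^ ((a + 2 * i) % n)) % M
  2^a*e[3,i]%M a i = trans (cong (_% M) (2^a*e[3,i] a i))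
    (%-cong-+ M (%-cong-+ M (2^k%M≡2^[k%n]%M a) (2^k%M≡2^[k%n]%M (a + i))) (2^k%M≡2^[k%n]%M (a + 2 * i)))

  distinct⇒2^p+2^q+2^r≤M : ∀ {p q r} → Distinct p q r → p < n → q < n → r < n → 2 ^ p + 2 ^ q + 2 ^ r ≤ M
  distinct⇒2^p+2^q+2^r≤M {p} {q} {r} distinct p<n q<n r<n =
    ≤-pred (subst (2 ^ p + 2 ^ q + 2 ^ r <_) 2^n≡1+M (distinct⇒2^p+2^q+2^r<2^n distinct p<n q<n r<n))

2^-injective : ∀ {m n} → 2 ^ m ≡ 2 ^ n → m ≡ n
2^-injective {m} {n} eq = trans (sym (⌊log₂[2^n]⌋≡n m)) (trans (cong ⌊log₂_⌋ eq) (⌊log₂[2^n]⌋≡n n))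

binary-2^[1+s]+1 : ∀ q r s → 2 ^ q + 2 ^ r ≡ 2 ^ suc s + 1 → (q ≡ 0 × r ≡ suc s) ⊎ (q ≡ suc s × r ≡ 0)
binary-2^[1+s]+1 zero    zero    s eq = ⊥-elim (even≢odd (2 ^ s) 0 (sym (+-cancelʳ-≡ 1 1 _ eq)))
binary-2^[1+s]+1 zero    (suc r) s eq = inj₁ (refl , 2^-injective (+-cancelʳ-≡ 1 _ _ (trans (+-comm (2 ^ suc r) 1) eq)))
binary-2^[1+s]+1 (suc q) zero    s eq = inj₂ (2^-injective (+-cancelʳ-≡ 1 _ _ eq) , refl)
binary-2^[1+s]+1 (suc q) (suc r) s eq =
  ⊥-elim (even≢odd (2 ^ q + 2 ^ r) (2 ^ s) (trans (*-distribˡ-+ 2 (2 ^ q) (2 ^ r)) (trans eq (+-comm _ 1))))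

1+2x+2y≡2z+2+1⇒x+y≡z+1 : ∀ x y z → 1 + 2 * x + 2 * y ≡ 2 * z + 2 + 1 → x + y ≡ z + 1
1+2x+2y≡2z+2+1⇒x+y≡z+1 x y z eq =
  *-cancelˡ-≡ (x + y) (z + 1) 2 (suc-injective (trans (lhs x y) (trans eq (rhs z))))
  where
  lhs : ∀ x y → 1 + 2 * (x + y) ≡ 1 + 2 * x + 2 * y
  lhs = solve-∀
  rhs : ∀ z → 2 * z + 2 + 1 ≡ 1 + 2 * (z + 1)
  rhs = solve-∀

2x+2y+2z≢2w+2+1 : ∀ x y z w → 2 * x + 2 * y + 2 * z ≢ 2 * w + 2 + 1
2x+2y+2z≢2w+2+1 x y z w eq = even≢odd (x + y + z) (w + 1) (trans (lhs x y z) (trans eq (rhs w)))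
  where
  lhs : ∀ x y z → 2 * (x + y + z) ≡ 2 * x + 2 * y + 2 * z
  lhs = solve-∀
  rhs : ∀ w → 2 * w + 2 + 1 ≡ 1 + 2 * (w + 1)
  rhs = solve-∀

-- q is one of the binary digits 0, 1, t of welch t, and s is the sum of the other two.
WelchDigits : ℕ → ℕ → ℕ → Set
WelchDigits t q s = (q ≡ 0 × s ≡ suc t) ⊎ (q ≡ 1 × s ≡ t) ⊎ (q ≡ t × s ≡ 1)

-- By parity exactly one exponent is 0; halving the other two leaves 2^(t−1) + 1.
binary-welch : ∀ {t} p q r → 2 ≤ t → Distinct p q r → 2 ^ p + 2 ^ q + 2 ^ r ≡ welch t → WelchDigits t q (p + r)
binary-welch zero    zero    r    _ (p≢q , _)     _ = ⊥-elim (p≢q refl)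
binary-welch zero    (suc q) zero _ (_ , _ , p≢r) _ = ⊥-elim (p≢r refl)
binary-welch (suc p) zero    zero _ (_ , q≢r , _) _ = ⊥-elim (q≢r refl)
binary-welch {suc (suc s)} zero (suc q) (suc r) (s≤s (s≤s _)) _ eq
  with binary-2^[1+s]+1 q r s (1+2x+2y≡2z+2+1⇒x+y≡z+1 (2 ^ q) (2 ^ r) (2 ^ suc s) eq)
... | inj₁ (refl , refl) = inj₂ (inj₁ (refl , refl))
... | inj₂ (refl , refl) = inj₂ (inj₂ (refl , refl))
binary-welch {suc (suc s)} (suc p) zero (suc r) (s≤s (s≤s _)) _ eq
  with binary-2^[1+s]+1 p r s (1+2x+2y≡2z+2+1⇒x+y≡z+1 (2 ^ p) (2 ^ r) (2 ^ suc s)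
         (trans (xy∙z≈yx∙z 1 (2 ^ suc p) (2 ^ suc r)) eq))
... | inj₁ (refl , refl) = inj₁ (refl , refl)
... | inj₂ (refl , refl) = inj₁ (refl , +-comm (suc (suc s)) 1)
binary-welch {suc (suc s)} (suc p) (suc q) zero (s≤s (s≤s _)) _ eq
  with binary-2^[1+s]+1 p q s (1+2x+2y≡2z+2+1⇒x+y≡z+1 (2 ^ p) (2 ^ q) (2 ^ suc s)
         (trans (xy∙z≈yz∙x 1 (2 ^ suc p) (2 ^ suc q)) eq))
... | inj₁ (refl , refl) = inj₂ (inj₂ (refl , refl))
... | inj₂ (refl , refl) = inj₂ (inj₁ (refl , +-identityʳ (suc (suc s))))
binary-welch {suc (suc s)} (suc p) (suc q) (suc r) (s≤s (s≤s _)) _ eq =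
  ⊥-elim (2x+2y+2z≢2w+2+1 (2 ^ p) (2 ^ q) (2 ^ r) (2 ^ suc s) eq)

welch-digits-not-in-progression : ∀ {t q s n} .{{_ : NonZero n}} →
  2 < t → t + t < n → WelchDigits t q s → s % n ≢ (q + q) % n
welch-digits-not-in-progression {t} {n = n} 2<t t+t<n = not-in-progression
  where
  1<t : 1 < t
  1<t = <-trans (n<1+n 1) 2<t
  t<n : t < n
  t<n = ≤-<-trans (m≤m+n t t) t+t<n
  1+t<n : 1 + t < n
  1+t<n = ≤-<-trans (subst (_≤ t + t) (+-comm t 1) (+-monoʳ-≤ t (<⇒≤ 1<t))) t+t<n

  not-in-progression : ∀ {q s} → WelchDigits t q s → s % n ≢ (q + q) % n
  not-in-progression (inj₁ (refl , refl)) eq =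
    1+n≢0 (%-injective-< 1+t<n (<-trans (n<1+n 0) (<-trans 1<t t<n)) eq)
  not-in-progression (inj₂ (inj₁ (refl , refl))) eq =
    <⇒≢ 2<t (sym (%-injective-< t<n (<-trans 2<t t<n) eq))
  not-in-progression (inj₂ (inj₂ (refl , refl))) eq =
    even≢odd t 0 (trans (cong (t +_) (+-identityʳ t)) (sym (%-injective-< (<-trans 1<t t<n) t+t<n eq)))

welch≢0 : ∀ t → welch t ≢ 0
welch≢0 t eq = 1+n≢0 (m+n≡0⇒n≡0 (2 ^ t + 2) eq)

welch<2^[2t+1]∸1 : ∀ {t} → 2 < t → welch t < 2 ^ (2 * t + 1) ∸ 1
welch<2^[2t+1]∸1 {t} 2<t = ∸-monoˡ-≤ 1 (begin
  2 + welch t      ≡⟨ 2+[x+2+1]≡x+5 (2 ^ t) ⟩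
  2 ^ t + 5        ≤⟨ +-monoʳ-≤ (2 ^ t) (≤-trans (m≤m+n 5 3) (^-monoʳ-≤ 2 2<t)) ⟩
  2 ^ t + 2 ^ t    ≡⟨ cong (2 ^ t +_) (sym (+-identityʳ (2 ^ t))) ⟩
  2 ^ suc t        ≤⟨ ^-monoʳ-≤ 2 (subst (_≤ 2 * t + 1) (+-comm t 1) (+-monoˡ-≤ 1 (m≤n*m t 2))) ⟩
  2 ^ (2 * t + 1)  ∎)
  where
  open ≤-Reasoning
  2+[x+2+1]≡x+5 : ∀ x → 2 + (x + 2 + 1) ≡ x + 5
  2+[x+2+1]≡x+5 = solve-∀

2^n≡1+[2^n∸1] : ∀ n → 2 ^ n ≡ 1 + (2 ^ n ∸ 1)
2^n≡1+[2^n∸1] n = sym (m+[n∸m]≡n (m^n>0 2 n))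

t+t<2t+1 : ∀ t → t + t < 2 * t + 1
t+t<2t+1 t = ≤-reflexive (1+[t+t]≡2t+1 t)
  where
  1+[t+t]≡2t+1 : ∀ t → suc (t + t) ≡ 2 * t + 1
  1+[t+t]≡2t+1 = solve-∀

theorem2 : (t : ℕ) → 2 < t → (i : ℕ) → 0 < i → i < 2 * t + 1 → ¬ (∃ λ a → (2 ^ a * e 3 i) ≡ welch t [mod (2 ^ (2 * t + 1) ∸ 1) ])
theorem2 t 2<t i 0<i i<n (a , M∣2^ae-W) =
  welch-digits-not-in-progression 2<t (t+t<2t+1 t)
    (binary-welch p q r (<⇒≤ 2<t) distinct sum≡W) (residues-in-progression a i)
  where
  n = 2 * t + 1
  M = 2 ^ n ∸ 1
  W<M : welch t < M
  W<M = welch<2^[2t+1]∸1 2<t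
  instance
    n≢0 : NonZero n
    n≢0 = >-nonZero (<-trans 0<i i<n)
    M≢0 : NonZero M
    M≢0 = >-nonZero (≤-<-trans z≤n W<M)
  p = a % n
  q = (a + i) % n
  r = (a + 2 * i) % n
  n∤i : ¬ n ∣ i
  n∤i = >⇒∤ {{>-nonZero 0<i}} i<n
  distinct : Distinct p q r
  distinct = distinct-residues a i n∤i (n∤i ∘ coprime-divisor (2t+1-coprime-2 t))
  sum≤M : 2 ^ p + 2 ^ q + 2 ^ r ≤ M
  sum≤M = distinct⇒2^p+2^q+2^r≤M (2^n≡1+[2^n∸1] n) distinct (m%n<n a n) (m%n<n (a + i) n) (m%n<n (a + 2 * i) n)
  sum≡W : 2 ^ p + 2 ^ q + 2 ^ r ≡ welch t
  sum≡W = m≤d⇒m%d≡n⇒m≡n sum≤M (welch≢0 t) (begin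
    (2 ^ p + 2 ^ q + 2 ^ r) % M  ≡⟨ sym (2^a*e[3,i]%M (2^n≡1+[2^n∸1] n) a i) ⟩
    2 ^ a * e 3 i % M            ≡⟨ d∣∣m-n∣⇒m%d≡n%d M M∣2^ae-W ⟩
    welch t % M                  ≡⟨ m<n⇒m%n≡m W<M ⟩
    welch t                      ∎)
    where open ≡-Reasoning
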